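{- For any finite sequence of channel actions $\sigma$ and any channel contents $x\in\Sigma^*$, the iteration number satisfies $L(\sigma,x)\le |x|\,(|\mathrm{rea}(\sigma)|+1)$.
   Context: Channel actions over a finite alphabet $\Sigma$ are $!w$ and $?w$ with $w\in\Sigma^*$. $\mathrm{rea}(?w)=w$, $\mathrm{rea}(!w)=\epsilon$, extended to sequences by concatenation. Lossy semantics: $x\xrightarrow{!w}y$ iff $y\sqsubseteq xw$, $x\xrightarrow{?w}y$ iff $wy\sqsubseteq x$ ($\sqsubseteq$ the scattered subword ordering), extended to sequences by composition. $\uparrow x=\{y : x\sqsubseteq y\}$. For a sequence $\sigma$, $\mathrm{pr}[\sigma](x)$ is the unique word $y$ with $\{z : \exists x'\in\uparrow x,\ z\xrightarrow{\sigma}x'\}=\uparrow y$ (it always exists; $\mathrm{pr}[\epsilon](x)=x$). The iteration number $L(\sigma,x)$ is the smallest integer $L$ such that there exists $\ell\le L$ with $\mathrm{pr}[\sigma^\ell](x)\sqsubseteq\mathrm{pr}[\sigma^{L+1}](x)$. -}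

module Defs where

open import Data.Nat using (ℕ; suc; _≤_)
open import Data.Fin using (Fin)
open import Data.List using (List; []; _∷_; _++_; concat; replicate; concatMap)
open import Data.Product using (Σ; ∃; _×_; _,_)
open import Function.Bundles using (_⇔_)
import Data.List.Relation.Binary.Sublist.Propositional as SL
open import Level using (0ℓ)

Word : ℕ → Set
Word k = List (Fin k)

_⊑_ : ∀ {k} → Word k → Word k → Set
_⊑_ = SL._⊆_

infix 4 _⊑_

data Action (k : ℕ) : Set where
  send : Word k → Action k
  recv : Word k → Action k

rea₁ : ∀ {k} → Action k → Word k
rea₁ (send w) = []
rea₁ (recv w) = w

rea : ∀ {k} → List (Action k) → Word k
rea = concatMap rea₁

-- lossy semantics of a single action
Step : ∀ {k} → Action k → Word k → Word k → Set
Step (send w) x y = y ⊑ x ++ w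
Step (recv w) x y = w ++ y ⊑ x

data Steps {k : ℕ} : List (Action k) → Word k → Word k → Set where
  done : ∀ {x} → Steps [] x x
  step : ∀ {a σ x y z} → Step a x y → Steps σ y z → Steps (a ∷ σ) x z

_^^_ : ∀ {k} → List (Action k) → ℕ → List (Action k)
σ ^^ n = concat (replicate n σ)

-- y = pr[σ](x), i.e. {z | ∃ x' ∈ ↑x, z -σ-> x'} = ↑y
IsPr : ∀ {k} → List (Action k) → Word k → Word k → Set
IsPr σ x y = ∀ z → (∃ λ x' → (x ⊑ x') × Steps σ z x') ⇔ (y ⊑ z)

-- The predecessors of ↑x under σ form ↑(pr σ x), where pr is computed action by action: ?w
-- prepends w, and !w cuts its argument y down to the shortest prefix z with y ⊑ z ++ w. Hence
-- pr[σ^(n+1)](x) is a prefix of r ++ pr[σ^n](x), with r = rea(σ) and m = |r|. While the sequence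
-- has the shape r^n ++ y, each step either keeps y (and is then a subword step) or strictly
-- shortens it; once it is a prefix of r^n, it and its successor are both prefixes of r^(n+1), so
-- it is either a prefix of its successor or strictly longer. The potential n·m + |y|·(m + 1),
-- respectively the length of the word, drops at each step, so a stationary pair appears within
-- |x|·(m + 1) steps.
module Submission where

open import Defs
open import Data.Nat using (ℕ; zero; suc; _≤_; _<_; _*_; _+_; z≤n; s≤s)
open import Data.Nat.Properties
open import Data.Nat.Induction using (<-wellFounded)
open import Data.Nat.Tactic.RingSolver using (solve-∀)
open import Induction.WellFounded using (Acc; acc)
open import Data.List using (List; []; _∷_; _++_; length; foldr)
open import Data.List.Properties using (++-assoc; ++-identityʳ; length-++; foldr-++)
import Data.List.Relation.Binary.Pointwise as Pointwise
open import Data.List.Relation.Binary.Prefix.Heterogeneous using (Prefix; []; _∷_)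
import Data.List.Relation.Binary.Prefix.Heterogeneous.Properties as Prefix
open import Data.List.Relation.Binary.Prefix.Homogeneous.Properties using () renaming (isPreorder to Prefix-isPreorder)
import Data.List.Relation.Binary.Sublist.Propositional.Properties as Sublist
open import Data.List.Relation.Binary.Sublist.Propositional using (_∷ʳ_; _∷_; ⊆-refl; ⊆-trans)
import Data.List.Relation.Binary.Sublist.DecPropositional as DecSublist
open import Data.Product using (∃; ∃-syntax; _×_; _,_)
open import Data.Sum using (_⊎_; inj₁; inj₂)
open import Data.Fin using (Fin)
open import Data.Fin.Properties using () renaming (_≟_ to _≟ᶠ_)
open import Data.Empty using (⊥-elim)
open import Function.Bundles using (_⇔_; mk⇔; Equivalence)
open import Relation.Binary.Structures using (IsPreorder)
open import Relation.Binary.PropositionalEquality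
  using (_≡_; refl; sym; trans; cong; subst; subst₂; isPreorder)
open import Relation.Nullary using (yes; no; ¬_)

private variable
  k : ℕ

module _ {k : ℕ} where

  infix 4 _≼_

  _≼_ : Word k → Word k → Set
  _≼_ = Prefix _≡_

  open IsPreorder (Prefix-isPreorder (isPreorder {A = Fin k}))
    public using () renaming (refl to ≼-refl; trans to ≼-trans)

  ≼-++ˡ : ∀ w {a b} → a ≼ b → w ++ a ≼ w ++ b
  ≼-++ˡ w = Prefix.++⁺ (Pointwise.refl refl)

  ≼⇒⊑ : ∀ {a b} → a ≼ b → a ⊑ b
  ≼⇒⊑ {b = b} [] = Sublist.[]⊆-universal b
  ≼⇒⊑ (refl ∷ p) = refl ∷ ≼⇒⊑ p

  ≼-≤-length : ∀ {a b c} → a ≼ c → b ≼ c → length a ≤ length b → a ≼ b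
  ≼-≤-length [] _ _ = []
  ≼-≤-length (refl ∷ a≼c) (refl ∷ b≼c) (s≤s le) = refl ∷ ≼-≤-length a≼c b≼c le

  ≼-++-split : ∀ u {v q} → q ≼ u ++ v → q ≼ u ⊎ ∃[ v′ ] q ≡ u ++ v′ × v′ ≼ v
  ≼-++-split [] {q = q} p = inj₂ (q , refl , p)
  ≼-++-split (c ∷ u) [] = inj₁ []
  ≼-++-split (c ∷ u) (refl ∷ p) with ≼-++-split u p
  ... | inj₁ q≼u = inj₁ (refl ∷ q≼u)
  ... | inj₂ (v′ , refl , v′≼v) = inj₂ (v′ , refl , v′≼v)

  infixr 8 _^_

  _^_ : Word k → ℕ → Word k
  r ^ zero = []
  r ^ suc n = r ++ r ^ n

  ^-≼-suc : ∀ r n → r ^ n ≼ r ^ suc n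
  ^-≼-suc r zero = []
  ^-≼-suc r (suc n) = ≼-++ˡ r (^-≼-suc r n)

  length-^ : ∀ r n → length (r ^ n) ≡ n * length r
  length-^ r zero = refl
  length-^ r (suc n) = trans (length-++ r) (cong (length r +_) (length-^ r n))

module Descent {P : ℕ → ℕ → Set} {Q : ℕ → Set}
               (progress : ∀ {n h} → P n h → Q n ⊎ ∃[ h′ ] h′ < h × P (suc n) h′) where

  descent-acc : ∀ {n h} → Acc _<_ h → P n h → ∃[ L ] L ≤ n + h × Q L
  descent-acc {n} {h} (acc rs) p with progress p
  ... | inj₁ q = n , m≤m+n n h , q
  ... | inj₂ (h′ , h′<h , p′) with descent-acc (rs h′<h) p′
  ... | L , L≤ , q = L , ≤-trans L≤ sn+h′≤n+h , q
    where sn+h′≤n+h = ≤-trans (≤-reflexive (sym (+-suc n h′))) (+-monoʳ-≤ n h′<h)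

  descent : ∀ {n h} → P n h → ∃[ L ] L ≤ n + h × Q L
  descent = descent-acc (<-wellFounded _)

module Stabilisation (r : Word k) (q : ℕ → Word k) (q-suc : ∀ n → q (suc n) ≼ r ++ q n) where

  m : ℕ
  m = length r

  Stationary : ℕ → Set
  Stationary n = q n ⊑ q (suc n)

  Periodic : ℕ → ℕ → Set
  Periodic n h = q n ≼ r ^ n × length (q n) ≤ h

  Pending : ℕ → ℕ → Set
  Pending n h = ∃[ y ] q n ≡ r ^ n ++ y × n * m + length y * (m + 1) ≤ h

  State : ℕ → ℕ → Set
  State n h = Pending n h ⊎ Periodic n h

  Progress : ℕ → ℕ → Set
  Progress n h = Stationary n ⊎ ∃[ h′ ] h′ < h × State (suc n) h′

  length-periodic : ∀ n {w} → w ≼ r ^ n → length w ≤ n * m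
  length-periodic n w≼ = ≤-trans (Prefix.length-mono w≼) (≤-reflexive (length-^ r n))

  potential-drop : ∀ n {a b} → a < b → suc n * m + a * (m + 1) < n * m + b * (m + 1)
  potential-drop n {a} a<b =
    ≤-trans (≤-reflexive (shift n m a)) (+-monoʳ-≤ (n * m) (*-monoˡ-≤ (m + 1) a<b))
    where
      shift : ∀ n m a → suc (suc n * m + a * (m + 1)) ≡ n * m + suc a * (m + 1)
      shift = solve-∀

  periodic-progress : ∀ {n h} → Periodic n h → Progress n h
  periodic-progress {n} (qn≼ , qn≤h)
    with ≼-trans (q-suc n) (≼-++ˡ r qn≼) | ≤-<-connex (length (q n)) (length (q (suc n)))
  ... | qsn≼ | inj₁ le = inj₁ (≼⇒⊑ (≼-≤-length (≼-trans qn≼ (^-≼-suc r n)) qsn≼ le))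
  ... | qsn≼ | inj₂ lt = inj₂ (_ , <-≤-trans lt qn≤h , inj₂ (qsn≼ , ≤-refl))

  pending-progress : ∀ {n h} → Pending n h → Progress n h
  pending-progress {n} ([] , qn≡ , pot≤h) =
    periodic-progress (qn≼ , ≤-trans (length-periodic n qn≼) (≤-trans (m≤m+n (n * m) 0) pot≤h))
    where
      qn≼ : q n ≼ r ^ n
      qn≼ = subst (_≼ r ^ n) (sym (trans qn≡ (++-identityʳ (r ^ n)))) ≼-refl
  pending-progress {n} (y@(_ ∷ _) , qn≡ , pot≤h) with ≼-++-split (r ^ suc n) qsn≼
    where
      qsn≼ : q (suc n) ≼ r ^ suc n ++ y
      qsn≼ = subst (q (suc n) ≼_) (trans (cong (r ++_) qn≡) (sym (++-assoc r (r ^ n) y))) (q-suc n)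
  ... | inj₁ qsn≼ = inj₂ (_ , <-≤-trans (≤-<-trans length≤ (potential-drop n {b = length y} (s≤s z≤n))) pot≤h ,
                          inj₂ (qsn≼ , ≤-refl))
    where length≤ = ≤-trans (length-periodic (suc n) qsn≼) (m≤m+n (suc n * m) 0)
  ... | inj₂ (y′ , qsn≡ , y′≼y) with ≤-<-connex (length y) (length y′)
  ... | inj₁ le = inj₁ (subst₂ _⊑_ (sym qn≡) (sym qsn≡)
          (Sublist.++⁺ (Sublist.++⁺ˡ r ⊆-refl) (≼⇒⊑ (≼-≤-length ≼-refl y′≼y le))))
  ... | inj₂ lt = inj₂ (_ , <-≤-trans (potential-drop n lt) pot≤h , inj₁ (y′ , qsn≡ , ≤-refl))

  progress : ∀ {n h} → State n h → Progress n h
  progress (inj₁ p) = pending-progress p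
  progress (inj₂ p) = periodic-progress p

  stabilises : ∀ x → q 0 ≡ x → ∃[ L ] L ≤ length x * (m + 1) × Stationary L
  stabilises x q0≡x = Descent.descent progress (inj₁ (x , q0≡x , ≤-refl))

module _ {k : ℕ} where
  open DecSublist (_≟ᶠ_ {k}) using (_⊆?_)

  unsend : Word k → Word k → Word k
  unsend w [] = []
  unsend w (c ∷ y) with (c ∷ y) ⊆? w
  ... | yes _ = []
  ... | no _ = c ∷ unsend w y

  unsend-∷ : ∀ {w c y} → ¬ (c ∷ y ⊑ w) → unsend w (c ∷ y) ≡ c ∷ unsend w y
  unsend-∷ {w} {c} {y} c∷y⋢w with (c ∷ y) ⊆? w
  ... | yes c∷y⊑w = ⊥-elim (c∷y⋢w c∷y⊑w)
  ... | no _ = refl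

  ⊑-unsend-++ : ∀ w y → y ⊑ unsend w y ++ w
  ⊑-unsend-++ w [] = Sublist.[]⊆-universal w
  ⊑-unsend-++ w (c ∷ y) with (c ∷ y) ⊆? w
  ... | yes c∷y⊑w = c∷y⊑w
  ... | no _ = refl ∷ ⊑-unsend-++ w y

  unsend-≼ : ∀ w y → unsend w y ≼ y
  unsend-≼ w [] = []
  unsend-≼ w (c ∷ y) with (c ∷ y) ⊆? w
  ... | yes _ = []
  ... | no _ = refl ∷ unsend-≼ w y

  unsend-least : ∀ w z y → y ⊑ z ++ w → unsend w y ⊑ z
  unsend-least w z [] _ = Sublist.[]⊆-universal z
  unsend-least w z (c ∷ y) y⊑zw with (c ∷ y) ⊆? w
  ... | yes _ = Sublist.[]⊆-universal z
  unsend-least w [] (c ∷ y) y⊑w | no c∷y⋢w = ⊥-elim (c∷y⋢w y⊑w)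
  unsend-least w (e ∷ z) (c ∷ y) (.e ∷ʳ y⊑zw) | no c∷y⋢w =
    e ∷ʳ subst (_⊑ z) (unsend-∷ c∷y⋢w) (unsend-least w z (c ∷ y) y⊑zw)
  unsend-least w (e ∷ z) (c ∷ y) (refl ∷ y⊑zw) | no _ = refl ∷ unsend-least w z y y⊑zw

  prAction : Action k → Word k → Word k
  prAction (send w) y = unsend w y
  prAction (recv w) y = w ++ y

  pr : List (Action k) → Word k → Word k
  pr σ y = foldr prAction y σ

  prAction-correct : ∀ a y z → (∃[ u ] y ⊑ u × Step a z u) ⇔ prAction a y ⊑ z
  prAction-correct (send w) y z = mk⇔
    (λ (u , y⊑u , u⊑zw) → unsend-least w z y (⊆-trans y⊑u u⊑zw))
    (λ unsend⊑z → y , ⊆-refl , ⊆-trans (⊑-unsend-++ w y) (Sublist.++⁺ unsend⊑z ⊆-refl))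
  prAction-correct (recv w) y z = mk⇔
    (λ (u , y⊑u , wu⊑z) → ⊆-trans (Sublist.++⁺ ⊆-refl y⊑u) wu⊑z)
    (λ wy⊑z → y , ⊆-refl , wy⊑z)

  pr-correct : ∀ σ y → IsPr σ y (pr σ y)
  pr-correct [] y z = mk⇔ (λ { (x′ , y⊑x′ , done) → y⊑x′ }) (λ y⊑z → z , y⊑z , done)
  pr-correct (a ∷ σ) y z = mk⇔
    (λ { (x′ , y⊑x′ , step z→u u→x′) →
           to (prAction-correct a _ z) (_ , to (pr-correct σ y _) (x′ , y⊑x′ , u→x′) , z→u) })
    λ prσ⊑z → let (u , pr⊑u , z→u) = from (prAction-correct a _ z) prσ⊑z
                  (x′ , y⊑x′ , u→x′) = from (pr-correct σ y u) pr⊑u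
              in x′ , y⊑x′ , step z→u u→x′
    where open Equivalence

  pr-≼ : ∀ σ y → pr σ y ≼ rea σ ++ y
  pr-≼ [] y = ≼-refl
  pr-≼ (send w ∷ σ) y = ≼-trans (unsend-≼ w (pr σ y)) (pr-≼ σ y)
  pr-≼ (recv w ∷ σ) y =
    subst (w ++ pr σ y ≼_) (sym (++-assoc w (rea σ) y)) (≼-++ˡ w (pr-≼ σ y))

IsPr-⊑ : ∀ {σ : List (Action k)} {x y y′} → IsPr σ x y → IsPr σ x y′ → y ⊑ y′
IsPr-⊑ {y′ = y′} y-pr y′-pr = Equivalence.to (y-pr y′) (Equivalence.from (y′-pr y′) ⊆-refl)

theorem10 : ∀ {k} (σ : List (Action k)) (x : Word k) (p : ℕ → Word k)
    → (∀ n → IsPr (σ ^^ n) x (p n))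
    → ∃ λ L → (L ≤ length x * (length (rea σ) + 1))
        × (∃ λ ℓ → (ℓ ≤ L) × (p ℓ ⊑ p (suc L)))
theorem10 σ x p p-pr =
  let (L , L≤ , qL⊑qsL) = stabilises x refl
  in L , L≤ , L , ≤-refl , ⊆-trans (p⊑q L) (⊆-trans qL⊑qsL (q⊑p (suc L)))
  where
    q : ℕ → Word _
    q n = pr (σ ^^ n) x

    q-suc : ∀ n → q (suc n) ≼ rea σ ++ q n
    q-suc n = subst (_≼ rea σ ++ q n) (sym (foldr-++ prAction x σ (σ ^^ n))) (pr-≼ σ (q n))

    open Stabilisation (rea σ) q q-suc

    p⊑q : ∀ n → p n ⊑ q n
    p⊑q n = IsPr-⊑ (p-pr n) (pr-correct (σ ^^ n) x)

    q⊑p : ∀ n → q n ⊑ p n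
    q⊑p n = IsPr-⊑ (pr-correct (σ ^^ n) x) (p-pr n)
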